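{- Let $q$ be a prime power, and let $H \le \mathrm{Aff}(q)$ be the subgroup $\{x \mapsto ax : a \in GF(q)^*\}$ (isomorphic to $C_{q-1}$). For any two distinct left cosets $C_1, C_2$ of $H$ in $\mathrm{Aff}(q)$, both different from $H$, the set $C_1 \cup C_2 \cup \{1\}$ is a $(q(q-1), 2q-1, 4)$ sum set in $\mathrm{Aff}(q)$.
   Context: $\mathrm{Aff}(q)$ is the group, under composition, of all maps $GF(q)\to GF(q)$ of the form $x \mapsto ax + b$ with $a \in GF(q)^*$, $b \in GF(q)$; it has order $q(q-1)$, and $1$ denotes its identity. For a finite group $X$ of order $w$, $T\subseteq X$ with $|T|=k$ is a $(w,k,\mu)$ sum set if every nonidentity element $a\in X$ admits exactly $\mu$ ordered pairs $(y_1,y_2)\in T\times T$ with $y_1y_2 = a$. -}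

module Defs where

open import Level using (0ℓ)
open import Data.Product using (Σ; ∃; _×_; _,_; proj₁; proj₂)
open import Data.Sum using (_⊎_)
open import Data.List using (List; length)
open import Data.List.Membership.Propositional using (_∈_)
open import Data.List.Relation.Unary.Unique.Propositional using (Unique)
open import Data.Nat using (ℕ)
open import Data.Empty using (⊥)
open import Relation.Nullary using (¬_)
open import Relation.Binary.PropositionalEquality
open import Function.Bundles using (_⇔_)
open import Algebra.Structures using (IsCommutativeRing)

HasSize : {X : Set} → (X → Set) → ℕ → Set
HasSize {X} P n =
  Σ (List X) λ xs → Unique xs × (∀ x → (x ∈ xs) ⇔ P x) × length xs ≡ n

record IsSumSet {X : Set} (_∙_ : X → X → X) (e : X) (T : X → Set)
                (w k μ : ℕ) : Set where
  field
    order    : HasSize {X} (λ _ → X) w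
    size     : HasSize T k
    products : ∀ a → ¬ (a ≡ e) →
               HasSize {X × X}
                 (λ p → T (proj₁ p) × T (proj₂ p) × (proj₁ p ∙ proj₂ p) ≡ a) μ

record FiniteField : Set₁ where
  infixl 7 _*_
  infixl 6 _+_
  field
    Carrier : Set
    _+_ _*_ : Carrier → Carrier → Carrier
    -_      : Carrier → Carrier
    0# 1#   : Carrier
    isCommutativeRing : IsCommutativeRing _≡_ _+_ _*_ -_ 0# 1#
    0≢1     : ¬ (0# ≡ 1#)
    inverse : ∀ x → ¬ (x ≡ 0#) → ∃ λ y → x * y ≡ 1#
    elements : List Carrier
    elements-unique   : Unique elements
    elements-complete : ∀ x → x ∈ elements

  order : ℕ
  order = length elements

module Aff (F : FiniteField) where
  open FiniteField F
  open IsCommutativeRing isCommutativeRing using (*-assoc; *-comm; *-identityˡ; zeroʳ)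

  nonzero-mul : ∀ {a c} → ¬ (a ≡ 0#) → ¬ (c ≡ 0#) → ¬ (a * c ≡ 0#)
  nonzero-mul {a} {c} a≢0 c≢0 ac≡0 with inverse a a≢0
  ... | y , ay≡1 = c≢0 (begin
        c               ≡⟨ sym (*-identityˡ c) ⟩
        1# * c          ≡⟨ cong (_* c) (sym ay≡1) ⟩
        a * y * c       ≡⟨ cong (_* c) (*-comm a y) ⟩
        y * a * c       ≡⟨ *-assoc y a c ⟩
        y * (a * c)     ≡⟨ cong (y *_) ac≡0 ⟩
        y * 0#          ≡⟨ zeroʳ y ⟩
        0# ∎)
    where open ≡-Reasoning

  -- An element of Aff(q): the map x ↦ a x + b with a ≠ 0.
  -- (The proof of a ≠ 0 is irrelevant, so equality of elements is
  -- equality of the maps' coefficients, i.e. equality of the maps.)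
  record AffMap : Set where
    constructor aff
    field
      a   : Carrier
      b   : Carrier
      .a≢0 : ¬ (a ≡ 0#)

  apply : AffMap → Carrier → Carrier
  apply (aff a b _) x = a * x + b

  -- composition: (f ∘ g)(x) = f (g x);
  -- a(cx + d) + b = (ac) x + (ad + b)
  _∘ᴬ_ : AffMap → AffMap → AffMap
  aff a b p ∘ᴬ aff c d r = aff (a * c) (a * d + b) (nonzero-mul p r)

  idᴬ : AffMap
  idᴬ = aff 1# 0# (λ 1≡0 → 0≢1 (sym 1≡0))

  H : AffMap → Set
  H f = AffMap.b f ≡ 0#

  leftCoset : AffMap → (AffMap → Set) → AffMap → Set
  leftCoset g K f = ∃ λ h → K h × f ≡ g ∘ᴬ h

  SameSet : (AffMap → Set) → (AffMap → Set) → Set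
  SameSet P Q = ∀ f → P f ⇔ Q f

-- The left cosets of H are the
-- classes of maps with a fixed translation part, so the set is {b = d₁} ∪ {b = d₂} ∪ {1} with
-- d₁, d₂ distinct and nonzero, of size 2(q − 1) + 1. For t ≠ 1 and dᵥ ≠ 0, a factorisation
-- t = u ∘ v with b u = dᵤ, b v = dᵥ forces a u = (b t − dᵤ)/dᵥ and a v = a t / a u, so it exists,
-- and is unique, exactly when b t ≠ dᵤ. If b t ∉ {d₁, d₂} each of the four choices of (dᵤ, dᵥ)
-- gives one factorisation; if b t = d₁, the two choices with dᵤ = d₁ fail, but t lies in the set
-- and t = 1 ∘ t = t ∘ 1 make up for them. Either way t has exactly four factorisations.

module Submission where

open import Algebra.Bundles using (Group)
import Algebra.Properties.Group as GroupProperties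
open import Algebra.Structures using (IsCommutativeRing)
open import Data.Empty using (⊥-elim)
import Data.Empty.Irrelevant as Irrelevant
open import Data.List using (List; []; _∷_; [_]; length; map; filter; cartesianProduct; _++_)
open import Data.List.Membership.Propositional using (_∈_)
open import Data.List.Membership.Propositional.Properties
  using (∈-map⁺; ∈-map⁻; ∈-++⁺ˡ; ∈-++⁺ʳ; ∈-++⁻; ∈-filter⁺; ∈-filter⁻; ∈-cartesianProduct⁺; ∈-cartesianProduct⁻)
open import Data.List.Properties using (length-map; length-++; map-∘; map-id-local; filter-accept; filter-reject; filter-all)
open import Data.List.Relation.Unary.All as All using (All; []; _∷_)
open import Data.List.Relation.Unary.AllPairs using ([]; _∷_)
open import Data.List.Relation.Unary.Any using (here; there)
open import Data.List.Relation.Unary.Unique.Propositional using (Unique)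
import Data.List.Relation.Unary.Unique.Propositional.Properties as Unique
import Data.Nat as ℕ
open import Data.Nat using (suc; _∸_; _<_; s≤s; z≤n)
import Data.Nat.Properties as ℕₚ
open import Data.Product using (Σ; _×_; _,_; proj₁; proj₂)
open import Data.Product.Function.NonDependent.Propositional using (_×-⇔_)
open import Data.Sum as Sum using (_⊎_; inj₁; inj₂)
open import Data.Sum.Function.Propositional using (_⊎-⇔_)
open import Defs
open import Function using (_∘_)
open import Function.Bundles using (_⇔_; mk⇔; Equivalence)
open import Function.Construct.Composition using (_⇔-∘_)
open import Function.Construct.Identity using (⇔-id)
open import Function.Construct.Symmetry using (⇔-sym)
open import Relation.Binary.Definitions using (DecidableEquality)
open import Relation.Binary.PropositionalEquality using (_≡_; refl; sym; trans; cong; cong₂; subst; module ≡-Reasoning)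
open import Relation.Nullary using (¬_; Dec; yes; no; contraposition)
open import Relation.Nullary.Decidable using (¬?)

open Equivalence using (to; from)

module _ {X : Set} where

  ≟-from-positions : ∀ {xs : List X} {x y} → Unique xs → x ∈ xs → y ∈ xs → Dec (x ≡ y)
  ≟-from-positions _           (here refl) (here refl) = yes refl
  ≟-from-positions (x∉ ∷ _)    (here refl) (there y∈) = no (All.lookup x∉ y∈)
  ≟-from-positions (x∉ ∷ _)    (there x∈) (here refl) = no (All.lookup x∉ x∈ ∘ sym)
  ≟-from-positions (_ ∷ xs!)   (there x∈) (there y∈) = ≟-from-positions xs! x∈ y∈

  enumeration⇒≟ : ∀ {xs : List X} → Unique xs → (∀ x → x ∈ xs) → DecidableEquality X
  enumeration⇒≟ xs! complete x y = ≟-from-positions xs! (complete x) (complete y)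

  HasSize-universe : ∀ {xs : List X} → Unique xs → (∀ x → x ∈ xs) → HasSize (λ _ → X) (length xs)
  HasSize-universe {xs} xs! complete = xs , xs! , (λ x → mk⇔ (λ _ → x) (λ _ → complete x)) , refl

  HasSize-cong : ∀ {P Q : X → Set} {n} → (∀ x → P x ⇔ Q x) → HasSize P n → HasSize Q n
  HasSize-cong P⇔Q (xs , xs! , ∈⇔P , len) = xs , xs! , (λ x → P⇔Q x ⇔-∘ ∈⇔P x) , len

  HasSize-singleton : ∀ (c : X) → HasSize (_≡ c) 1
  HasSize-singleton c = [ c ] , [] ∷ [] , (λ x → mk⇔ (λ { (here x≡c) → x≡c ; (there ()) }) here) , refl

  HasSize-⊎ : ∀ {P Q : X → Set} {m n} → (∀ {x} → P x → ¬ Q x) →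
              HasSize P m → HasSize Q n → HasSize (λ x → P x ⊎ Q x) (m ℕ.+ n)
  HasSize-⊎ P⇒¬Q (xs , xs! , ∈⇔P , refl) (ys , ys! , ∈⇔Q , refl) =
    xs ++ ys ,
    Unique.++⁺ xs! ys! (λ (x∈xs , x∈ys) → P⇒¬Q (to (∈⇔P _) x∈xs) (to (∈⇔Q _) x∈ys)) ,
    (λ x → mk⇔ (Sum.map (to (∈⇔P x)) (to (∈⇔Q x)) ∘ ∈-++⁻ xs)
               (Sum.[ ∈-++⁺ˡ ∘ from (∈⇔P x) , ∈-++⁺ʳ xs ∘ from (∈⇔Q x) ])) ,
    length-++ xs

  module _ (_≟_ : DecidableEquality X) where

    length-filter-≢ : ∀ {c} {xs : List X} → Unique xs → c ∈ xs →
                      suc (length (filter (λ x → ¬? (x ≟ c)) xs)) ≡ length xs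
    length-filter-≢ {xs = x ∷ xs} (x∉xs ∷ _) (here refl) = cong suc (begin
      length (filter (λ y → ¬? (y ≟ x)) (x ∷ xs)) ≡⟨ cong length (filter-reject (λ y → ¬? (y ≟ x)) (λ x≢x → x≢x refl)) ⟩
      length (filter (λ y → ¬? (y ≟ x)) xs)       ≡⟨ cong length (filter-all (λ y → ¬? (y ≟ x)) (All.map (_∘ sym) x∉xs)) ⟩
      length xs                                   ∎)
      where open ≡-Reasoning
    length-filter-≢ {c} {x ∷ xs} (x∉xs ∷ xs!) (there c∈xs) = begin
      suc (length (filter (λ y → ¬? (y ≟ c)) (x ∷ xs))) ≡⟨ cong (suc ∘ length) (filter-accept (λ y → ¬? (y ≟ c)) (All.lookup x∉xs c∈xs)) ⟩
      suc (suc (length (filter (λ y → ¬? (y ≟ c)) xs))) ≡⟨ cong suc (length-filter-≢ xs! c∈xs) ⟩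
      suc (length xs)                                    ∎
      where open ≡-Reasoning

    HasSize-remove : ∀ {P : X → Set} {n} c → P c → HasSize P n → HasSize (λ x → P x × ¬ x ≡ c) (n ∸ 1)
    HasSize-remove c Pc (xs , xs! , ∈⇔P , refl) =
      filter (λ x → ¬? (x ≟ c)) xs ,
      Unique.filter⁺ (λ x → ¬? (x ≟ c)) xs! ,
      (λ x → mk⇔ (λ x∈ → let x∈xs , x≢c = ∈-filter⁻ (λ y → ¬? (y ≟ c)) x∈ in to (∈⇔P x) x∈xs , x≢c)
                 (λ (Px , x≢c) → ∈-filter⁺ (λ y → ¬? (y ≟ c)) (from (∈⇔P x) Px) x≢c)) ,
      cong (_∸ 1) (length-filter-≢ xs! (from (∈⇔P c) Pc))

length-cartesianProduct : ∀ {X Y : Set} (xs : List X) (ys : List Y) →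
                          length (cartesianProduct xs ys) ≡ length xs ℕ.* length ys
length-cartesianProduct []       ys = refl
length-cartesianProduct (x ∷ xs) ys = begin
  length (map (x ,_) ys ++ cartesianProduct xs ys)        ≡⟨ length-++ (map (x ,_) ys) ⟩
  length (map (x ,_) ys) ℕ.+ length (cartesianProduct xs ys) ≡⟨ cong₂ ℕ._+_ (length-map (x ,_) ys) (length-cartesianProduct xs ys) ⟩
  length ys ℕ.+ length xs ℕ.* length ys                        ∎
  where open ≡-Reasoning

HasSize-× : ∀ {X Y : Set} {P : X → Set} {Q : Y → Set} {m n} →
            HasSize P m → HasSize Q n → HasSize (λ z → P (proj₁ z) × Q (proj₂ z)) (m ℕ.* n)
HasSize-× (xs , xs! , ∈⇔P , refl) (ys , ys! , ∈⇔Q , refl) =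
  cartesianProduct xs ys ,
  Unique.cartesianProduct⁺ xs! ys! ,
  (λ (x , y) → mk⇔ (λ xy∈ → let x∈ , y∈ = ∈-cartesianProduct⁻ xs ys xy∈ in to (∈⇔P x) x∈ , to (∈⇔Q y) y∈)
                   (λ (Px , Qy) → ∈-cartesianProduct⁺ (from (∈⇔P x) Px) (from (∈⇔Q y) Qy))) ,
  length-cartesianProduct xs ys

HasSize-bijection : ∀ {X Y : Set} {P : X → Set} {Q : Y → Set} {n} (f : X → Y) (g : Y → X) →
                    (∀ {x} → P x → Q (f x)) → (∀ {y} → Q y → P (g y)) →
                    (∀ {x} → P x → g (f x) ≡ x) → (∀ {y} → Q y → f (g y) ≡ y) →
                    HasSize P n → HasSize Q n
HasSize-bijection {Q = Q} f g P⇒Qf Q⇒Pg g∘f≗id f∘g≗id (xs , xs! , ∈⇔P , refl) =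
  map f xs , Unique.map⁻ (subst Unique (sym g∘f[xs]≡xs) xs!) , ∈⇔Q , length-map f xs
  where
  g∘f[xs]≡xs : map g (map f xs) ≡ xs
  g∘f[xs]≡xs = trans (sym (map-∘ xs)) (map-id-local (All.tabulate (g∘f≗id ∘ to (∈⇔P _))))

  ∈⇔Q : ∀ y → y ∈ map f xs ⇔ Q y
  ∈⇔Q y = mk⇔ (λ y∈ → let x , x∈xs , y≡fx = ∈-map⁻ f y∈ in subst Q (sym y≡fx) (P⇒Qf (to (∈⇔P x) x∈xs)))
              (λ Qy → subst (_∈ map f xs) (f∘g≗id Qy) (∈-map⁺ f (from (∈⇔P (g y)) (Q⇒Pg Qy))))

Factorisations : ∀ {X : Set} → (X → X → X) → (X → Set) → X → X × X → Set
Factorisations _∙_ T a p = T (proj₁ p) × T (proj₂ p) × (proj₁ p ∙ proj₂ p) ≡ a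

Factorisations-cong : ∀ {X : Set} {_∙_ : X → X → X} {T T′ : X → Set} → (∀ x → T x ⇔ T′ x) →
                      ∀ a p → Factorisations _∙_ T a p ⇔ Factorisations _∙_ T′ a p
Factorisations-cong T⇔T′ _ p = T⇔T′ (proj₁ p) ×-⇔ (T⇔T′ (proj₂ p) ×-⇔ ⇔-id _)

IsSumSet-cong : ∀ {X : Set} {_∙_ : X → X → X} {e : X} {T T′ : X → Set} {w k μ} →
                (∀ x → T x ⇔ T′ x) → IsSumSet _∙_ e T w k μ → IsSumSet _∙_ e T′ w k μ
IsSumSet-cong T⇔T′ T-sumSet = record
  { order    = order
  ; size     = HasSize-cong T⇔T′ size
  ; products = λ a a≢e → HasSize-cong (Factorisations-cong T⇔T′ a) (products a a≢e)
  }
  where open IsSumSet T-sumSet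

n∸1+[n∸1+1]≡2n∸1 : ∀ n → 0 < n → n ∸ 1 ℕ.+ (n ∸ 1 ℕ.+ 1) ≡ 2 ℕ.* n ∸ 1
n∸1+[n∸1+1]≡2n∸1 (suc m) _ = cong (m ℕ.+_) (trans (ℕₚ.+-comm m 1) (cong suc (sym (ℕₚ.+-identityʳ m))))

module AffineGroup (F : FiniteField) where
  open FiniteField F
  open IsCommutativeRing isCommutativeRing
    using (+-isGroup; _-_; +-identityˡ; +-identityʳ; *-assoc; *-comm; *-identityˡ; *-identityʳ; zeroʳ)
  open Aff F public
  open AffMap using (a; b)

  +-group : Group _ _
  +-group = record { isGroup = +-isGroup }

  open GroupProperties +-group using (//-rightDividesˡ; //-rightDividesʳ; identityˡ-unique; x∙y⁻¹≈ε⇒x≈y)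

  _≟_ : DecidableEquality Carrier
  _≟_ = enumeration⇒≟ elements-unique elements-complete

  -- Junk value: 0# ⁻¹ = 0#.
  infix 8 _⁻¹
  _⁻¹ : Carrier → Carrier
  d ⁻¹ with d ≟ 0#
  ... | yes _   = 0#
  ... | no d≢0 = proj₁ (inverse d d≢0)

  infixl 7 _/_
  _/_ : Carrier → Carrier → Carrier
  c / d = c * d ⁻¹

  *-inverseʳ : ∀ {d} → ¬ d ≡ 0# → d * d ⁻¹ ≡ 1#
  *-inverseʳ {d} d≢0 with d ≟ 0#
  ... | yes d≡0  = ⊥-elim (d≢0 d≡0)
  ... | no d≢0′ = proj₂ (inverse d d≢0′)

  ⁻¹-nonzero : ∀ {d} → ¬ d ≡ 0# → ¬ d ⁻¹ ≡ 0#
  ⁻¹-nonzero {d} d≢0 d⁻¹≡0 = 0≢1 (begin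
    0#         ≡⟨ zeroʳ d ⟨
    d * 0#     ≡⟨ cong (d *_) d⁻¹≡0 ⟨
    d * d ⁻¹   ≡⟨ *-inverseʳ d≢0 ⟩
    1#         ∎)
    where open ≡-Reasoning

  /-nonzero : ∀ {c d} → ¬ c ≡ 0# → ¬ d ≡ 0# → ¬ c / d ≡ 0#
  /-nonzero c≢0 d≢0 = nonzero-mul c≢0 (⁻¹-nonzero d≢0)

  /-*-cancel : ∀ {d} c → ¬ d ≡ 0# → c / d * d ≡ c
  /-*-cancel {d} c d≢0 = begin
    c * d ⁻¹ * d   ≡⟨ *-assoc c (d ⁻¹) d ⟩
    c * (d ⁻¹ * d) ≡⟨ cong (c *_) (trans (*-comm (d ⁻¹) d) (*-inverseʳ d≢0)) ⟩
    c * 1#         ≡⟨ *-identityʳ c ⟩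
    c              ∎
    where open ≡-Reasoning

  *-/-cancel : ∀ {d} c → ¬ d ≡ 0# → c * d / d ≡ c
  *-/-cancel {d} c d≢0 = begin
    c * d * d ⁻¹   ≡⟨ *-assoc c d (d ⁻¹) ⟩
    c * (d * d ⁻¹) ≡⟨ cong (c *_) (*-inverseʳ d≢0) ⟩
    c * 1#         ≡⟨ *-identityʳ c ⟩
    c              ∎
    where open ≡-Reasoning

  *-/-cancelˡ : ∀ {d} c → ¬ d ≡ 0# → d * (c / d) ≡ c
  *-/-cancelˡ {d} c d≢0 = trans (*-comm d (c / d)) (/-*-cancel c d≢0)

  x*0+y≡y : ∀ x y → x * 0# + y ≡ y
  x*0+y≡y x y = trans (cong (_+ y) (zeroʳ x)) (+-identityˡ y)

  a-nonzero : ∀ f → ¬ a f ≡ 0#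
  a-nonzero (aff _ _ a≢0) a≡0 = Irrelevant.⊥-elim (a≢0 a≡0)

  AffMap-≡ : ∀ {f g} → a f ≡ a g → b f ≡ b g → f ≡ g
  AffMap-≡ {aff _ _ _} {aff _ _ _} refl refl = refl

  ∘ᴬ-identityˡ : ∀ f → idᴬ ∘ᴬ f ≡ f
  ∘ᴬ-identityˡ f = AffMap-≡ (*-identityˡ (a f)) (trans (+-identityʳ _) (*-identityˡ (b f)))

  ∘ᴬ-identityʳ : ∀ f → f ∘ᴬ idᴬ ≡ f
  ∘ᴬ-identityʳ f = AffMap-≡ (*-identityʳ (a f)) (x*0+y≡y (a f) (b f))

  -- Junk value: a zero slope is sent to idᴬ.
  fromCoefficients : Carrier × Carrier → AffMap
  fromCoefficients (c , s) with s ≟ 0#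
  ... | yes _   = idᴬ
  ... | no s≢0 = aff s c s≢0

  coefficients : AffMap → Carrier × Carrier
  coefficients f = b f , a f

  coefficients-fromCoefficients : ∀ {z} → ¬ proj₂ z ≡ 0# → coefficients (fromCoefficients z) ≡ z
  coefficients-fromCoefficients {c , s} s≢0 with s ≟ 0#
  ... | yes s≡0 = ⊥-elim (s≢0 s≡0)
  ... | no _    = refl

  fromCoefficients-coefficients : ∀ f → fromCoefficients (coefficients f) ≡ f
  fromCoefficients-coefficients f with a f ≟ 0#
  ... | yes a≡0 = ⊥-elim (a-nonzero f a≡0)
  ... | no _    = refl

  HasSize-AffMap : ∀ {P : Carrier × Carrier → Set} {Q : AffMap → Set} {n} →
                   (∀ {z} → P z → ¬ proj₂ z ≡ 0#) → (∀ f → Q f ⇔ P (coefficients f)) →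
                   HasSize P n → HasSize Q n
  HasSize-AffMap {P} P⇒s≢0 Q⇔P = HasSize-bijection fromCoefficients coefficients
    (λ {z} Pz → from (Q⇔P _) (subst P (sym (coefficients-fromCoefficients (P⇒s≢0 Pz))) Pz))
    (to (Q⇔P _))
    (coefficients-fromCoefficients ∘ P⇒s≢0)
    (λ {f} _ → fromCoefficients-coefficients f)

  nonzero-size : HasSize (λ s → ¬ s ≡ 0#) (order ∸ 1)
  nonzero-size = HasSize-cong (λ s → mk⇔ proj₂ (s ,_))
    (HasSize-remove _≟_ 0# 0# (HasSize-universe elements-unique elements-complete))

  order-size : HasSize (λ _ → AffMap) (order ℕ.* (order ∸ 1))
  order-size = HasSize-AffMap proj₂ (λ f → mk⇔ (λ _ → b f , a-nonzero f) (λ _ → f))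
    (HasSize-× (HasSize-universe elements-unique elements-complete) nonzero-size)

  translationClass-size : ∀ d → HasSize (λ f → b f ≡ d) (order ∸ 1)
  translationClass-size d = subst (HasSize _) (ℕₚ.*-identityˡ (order ∸ 1))
    (HasSize-AffMap proj₂ (λ f → mk⇔ (_, a-nonzero f) proj₁)
      (HasSize-× (HasSize-singleton d) nonzero-size))

  leftCoset-H⇔ : ∀ g f → leftCoset g H f ⇔ b f ≡ b g
  leftCoset-H⇔ g f = mk⇔ translation-of-product witness
    where
    translation-of-product : leftCoset g H f → b f ≡ b g
    translation-of-product (h , b[h]≡0 , refl) = trans (cong (λ c → a g * c + b g) b[h]≡0) (x*0+y≡y (a g) (b g))

    witness : b f ≡ b g → leftCoset g H f
    witness b[f]≡b[g] =
      aff (a f / a g) 0# (/-nonzero (a-nonzero f) (a-nonzero g)) , refl ,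
      AffMap-≡ (sym (*-/-cancelˡ (a f) (a-nonzero g))) (trans b[f]≡b[g] (sym (x*0+y≡y (a g) (b g))))

  distinct-cosets⇒distinct-translations : ∀ {P Q : AffMap → Set} {c c′} →
    (∀ f → P f ⇔ b f ≡ c) → (∀ f → Q f ⇔ b f ≡ c′) → ¬ SameSet P Q → ¬ c ≡ c′
  distinct-cosets⇒distinct-translations P⇔ Q⇔ P≠Q refl = P≠Q (λ f → ⇔-sym (Q⇔ f) ⇔-∘ P⇔ f)

  slope : AffMap → Carrier → Carrier → Carrier
  slope t dᵤ dᵥ = (b t - dᵤ) / dᵥ

  slope-nonzero : ∀ t {dᵤ dᵥ} → ¬ dᵥ ≡ 0# → ¬ b t ≡ dᵤ → ¬ slope t dᵤ dᵥ ≡ 0#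
  slope-nonzero t {dᵤ} dᵥ≢0 bt≢dᵤ = /-nonzero (bt≢dᵤ ∘ x∙y⁻¹≈ε⇒x≈y (b t) dᵤ) dᵥ≢0

  -- The proofs are irrelevant, so factorisations built from different proofs are definitionally equal.
  factor : (t : AffMap) (dᵤ dᵥ : Carrier) → .(¬ dᵥ ≡ 0#) → .(¬ b t ≡ dᵤ) → AffMap × AffMap
  factor t dᵤ dᵥ dᵥ≢0 bt≢dᵤ =
    aff (slope t dᵤ dᵥ) dᵤ (slope-nonzero t dᵥ≢0 bt≢dᵤ) ,
    aff (a t / slope t dᵤ dᵥ) dᵥ (/-nonzero (a-nonzero t) (slope-nonzero t dᵥ≢0 bt≢dᵤ))

  factor-∘ : ∀ t {dᵤ dᵥ} (dᵥ≢0 : ¬ dᵥ ≡ 0#) (bt≢dᵤ : ¬ b t ≡ dᵤ) →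
             proj₁ (factor t dᵤ dᵥ dᵥ≢0 bt≢dᵤ) ∘ᴬ proj₂ (factor t dᵤ dᵥ dᵥ≢0 bt≢dᵤ) ≡ t
  factor-∘ t {dᵤ} {dᵥ} dᵥ≢0 bt≢dᵤ = AffMap-≡
    (*-/-cancelˡ (a t) (slope-nonzero t dᵥ≢0 bt≢dᵤ))
    (begin
      (b t - dᵤ) / dᵥ * dᵥ + dᵤ ≡⟨ cong (_+ dᵤ) (/-*-cancel (b t - dᵤ) dᵥ≢0) ⟩
      b t - dᵤ + dᵤ             ≡⟨ //-rightDividesˡ dᵤ (b t) ⟩
      b t                       ∎)
    where open ≡-Reasoning

  factor-unique : ∀ {t u v dᵤ dᵥ} (dᵥ≢0 : ¬ dᵥ ≡ 0#) → b u ≡ dᵤ → b v ≡ dᵥ → u ∘ᴬ v ≡ t →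
                  Σ (¬ b t ≡ dᵤ) λ bt≢dᵤ → (u , v) ≡ factor t dᵤ dᵥ dᵥ≢0 bt≢dᵤ
  factor-unique {u = u} {v} dᵥ≢0 refl refl refl =
    nonzero-mul (a-nonzero u) dᵥ≢0 ∘ identityˡ-unique (a u * b v) (b u) ,
    cong₂ _,_ (AffMap-≡ (sym slope≡a[u]) refl) (AffMap-≡ (sym a[v]) refl)
    where
    open ≡-Reasoning
    slope≡a[u] : slope (u ∘ᴬ v) (b u) (b v) ≡ a u
    slope≡a[u] = begin
      (a u * b v + b u - b u) / b v ≡⟨ cong (_/ b v) (//-rightDividesʳ (b u) (a u * b v)) ⟩
      a u * b v / b v               ≡⟨ *-/-cancel (a u) dᵥ≢0 ⟩
      a u                           ∎
    a[v] : a u * a v / slope (u ∘ᴬ v) (b u) (b v) ≡ a v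
    a[v] = begin
      a u * a v / slope (u ∘ᴬ v) (b u) (b v) ≡⟨ cong (a u * a v /_) slope≡a[u] ⟩
      a u * a v / a u                        ≡⟨ cong (_/ a u) (*-comm (a u) (a v)) ⟩
      a v * a u / a u                        ≡⟨ *-/-cancel (a v) (a-nonzero u) ⟩
      a v                                    ∎

  order-positive : 0 < order
  order-positive with elements | elements-complete 0#
  ... | _ ∷ _ | _ = s≤s z≤n

  -- By leftCoset-H⇔, the left cosets of H are the classes b f ≡ d.
  CosetsWithIdentity : Carrier → Carrier → AffMap → Set
  CosetsWithIdentity d₁ d₂ f = b f ≡ d₁ ⊎ b f ≡ d₂ ⊎ f ≡ idᴬ

  CosetsWithIdentity-swap : ∀ {d₁ d₂} f → CosetsWithIdentity d₁ d₂ f → CosetsWithIdentity d₂ d₁ f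
  CosetsWithIdentity-swap _ (inj₁ b≡d₁)        = inj₂ (inj₁ b≡d₁)
  CosetsWithIdentity-swap _ (inj₂ (inj₁ b≡d₂)) = inj₁ b≡d₂
  CosetsWithIdentity-swap _ (inj₂ (inj₂ f≡id)) = inj₂ (inj₂ f≡id)

  private
    differ₁ : ∀ {p q : AffMap × AffMap} → ¬ b (proj₁ p) ≡ b (proj₁ q) → ¬ p ≡ q
    differ₁ = contraposition (cong (b ∘ proj₁))

    differ₂ : ∀ {p q : AffMap × AffMap} → ¬ b (proj₂ p) ≡ b (proj₂ q) → ¬ p ≡ q
    differ₂ = contraposition (cong (b ∘ proj₂))

  module _ {d₁ d₂ : Carrier} (d₁≢d₂ : ¬ d₁ ≡ d₂) (d₁≢0 : ¬ d₁ ≡ 0#) (d₂≢0 : ¬ d₂ ≡ 0#) where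

    private
      T : AffMap → Set
      T = CosetsWithIdentity d₁ d₂

    CosetsWithIdentity-size : HasSize T (2 ℕ.* order ∸ 1)
    CosetsWithIdentity-size = subst (HasSize T) (n∸1+[n∸1+1]≡2n∸1 order order-positive)
      (HasSize-⊎ (λ b≡d₁ → Sum.[ d₁≢d₂ ∘ trans (sym b≡d₁) , d₁≢0 ∘ trans (sym b≡d₁) ∘ cong b ])
        (translationClass-size d₁)
        (HasSize-⊎ (λ b≡d₂ → d₂≢0 ∘ trans (sym b≡d₂) ∘ cong b)
          (translationClass-size d₂)
          (HasSize-singleton idᴬ)))

    factorisations-through : ∀ {t} → ¬ t ≡ idᴬ → b t ≡ d₁ → HasSize (Factorisations _∘ᴬ_ T t) 4
    factorisations-through {t} t≢id bt≡d₁ = candidates , distinct , (λ z → mk⇔ members (classify z)) , refl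
      where
      bt≢d₂ : ¬ b t ≡ d₂
      bt≢d₂ = d₁≢d₂ ∘ trans (sym bt≡d₁)

      candidates : List (AffMap × AffMap)
      candidates = (idᴬ , t) ∷ (t , idᴬ) ∷ factor t d₂ d₁ d₁≢0 bt≢d₂ ∷ factor t d₂ d₂ d₂≢0 bt≢d₂ ∷ []

      distinct : Unique candidates
      distinct = (contraposition (cong proj₁) (t≢id ∘ sym) ∷ differ₁ (d₂≢0 ∘ sym) ∷ differ₁ (d₂≢0 ∘ sym) ∷ [])
               ∷ (differ₂ (d₁≢0 ∘ sym) ∷ differ₂ (d₂≢0 ∘ sym) ∷ [])
               ∷ (differ₂ d₁≢d₂ ∷ [])
               ∷ [] ∷ []

      members : ∀ {z} → z ∈ candidates → Factorisations _∘ᴬ_ T t z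
      members (here refl)                         = inj₂ (inj₂ refl) , inj₁ bt≡d₁ , ∘ᴬ-identityˡ t
      members (there (here refl))                 = inj₁ bt≡d₁ , inj₂ (inj₂ refl) , ∘ᴬ-identityʳ t
      members (there (there (here refl)))         = inj₂ (inj₁ refl) , inj₁ refl , factor-∘ t d₁≢0 bt≢d₂
      members (there (there (there (here refl)))) = inj₂ (inj₁ refl) , inj₂ (inj₁ refl) , factor-∘ t d₂≢0 bt≢d₂

      classify : ∀ z → Factorisations _∘ᴬ_ T t z → z ∈ candidates
      classify (u , v) (inj₂ (inj₂ refl) , _ , v≡t) = here (cong (idᴬ ,_) (trans (sym (∘ᴬ-identityˡ v)) v≡t))
      classify (u , v) (_ , inj₂ (inj₂ refl) , u≡t) = there (here (cong (_, idᴬ) (trans (sym (∘ᴬ-identityʳ u)) u≡t)))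
      classify (u , v) (inj₁ bu , inj₁ bv , uv≡t) = ⊥-elim (proj₁ (factor-unique {u = u} {v} d₁≢0 bu bv uv≡t) bt≡d₁)
      classify (u , v) (inj₁ bu , inj₂ (inj₁ bv) , uv≡t) = ⊥-elim (proj₁ (factor-unique {u = u} {v} d₂≢0 bu bv uv≡t) bt≡d₁)
      classify (u , v) (inj₂ (inj₁ bu) , inj₁ bv , uv≡t) =
        there (there (here (proj₂ (factor-unique d₁≢0 bu bv uv≡t))))
      classify (u , v) (inj₂ (inj₁ bu) , inj₂ (inj₁ bv) , uv≡t) =
        there (there (there (here (proj₂ (factor-unique d₂≢0 bu bv uv≡t)))))

    factorisations-avoiding : ∀ {t} → ¬ t ≡ idᴬ → ¬ b t ≡ d₁ → ¬ b t ≡ d₂ → HasSize (Factorisations _∘ᴬ_ T t) 4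
    factorisations-avoiding {t} t≢id bt≢d₁ bt≢d₂ = candidates , distinct , (λ z → mk⇔ members (classify z)) , refl
      where
      candidates : List (AffMap × AffMap)
      candidates = factor t d₁ d₁ d₁≢0 bt≢d₁ ∷ factor t d₁ d₂ d₂≢0 bt≢d₁
                 ∷ factor t d₂ d₁ d₁≢0 bt≢d₂ ∷ factor t d₂ d₂ d₂≢0 bt≢d₂ ∷ []

      distinct : Unique candidates
      distinct = (differ₂ d₁≢d₂ ∷ differ₁ d₁≢d₂ ∷ differ₁ d₁≢d₂ ∷ [])
               ∷ (differ₁ d₁≢d₂ ∷ differ₁ d₁≢d₂ ∷ [])
               ∷ (differ₂ d₁≢d₂ ∷ [])
               ∷ [] ∷ []

      members : ∀ {z} → z ∈ candidates → Factorisations _∘ᴬ_ T t z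
      members (here refl)                         = inj₁ refl , inj₁ refl , factor-∘ t d₁≢0 bt≢d₁
      members (there (here refl))                 = inj₁ refl , inj₂ (inj₁ refl) , factor-∘ t d₂≢0 bt≢d₁
      members (there (there (here refl)))         = inj₂ (inj₁ refl) , inj₁ refl , factor-∘ t d₁≢0 bt≢d₂
      members (there (there (there (here refl)))) = inj₂ (inj₁ refl) , inj₂ (inj₁ refl) , factor-∘ t d₂≢0 bt≢d₂

      t∉T : ¬ T t
      t∉T = Sum.[ bt≢d₁ , Sum.[ bt≢d₂ , t≢id ] ]

      classify : ∀ z → Factorisations _∘ᴬ_ T t z → z ∈ candidates
      classify (u , v) (inj₂ (inj₂ refl) , Tv , v≡t) = ⊥-elim (t∉T (subst T (trans (sym (∘ᴬ-identityˡ v)) v≡t) Tv))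
      classify (u , v) (Tu , inj₂ (inj₂ refl) , u≡t) = ⊥-elim (t∉T (subst T (trans (sym (∘ᴬ-identityʳ u)) u≡t) Tu))
      classify (u , v) (inj₁ bu , inj₁ bv , uv≡t) = here (proj₂ (factor-unique d₁≢0 bu bv uv≡t))
      classify (u , v) (inj₁ bu , inj₂ (inj₁ bv) , uv≡t) = there (here (proj₂ (factor-unique d₂≢0 bu bv uv≡t)))
      classify (u , v) (inj₂ (inj₁ bu) , inj₁ bv , uv≡t) =
        there (there (here (proj₂ (factor-unique d₁≢0 bu bv uv≡t))))
      classify (u , v) (inj₂ (inj₁ bu) , inj₂ (inj₁ bv) , uv≡t) =
        there (there (there (here (proj₂ (factor-unique d₂≢0 bu bv uv≡t)))))

  CosetsWithIdentity-isSumSet : ∀ {d₁ d₂} → ¬ d₁ ≡ d₂ → ¬ d₁ ≡ 0# → ¬ d₂ ≡ 0# →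
    IsSumSet _∘ᴬ_ idᴬ (CosetsWithIdentity d₁ d₂) (order ℕ.* (order ∸ 1)) (2 ℕ.* order ∸ 1) 4
  CosetsWithIdentity-isSumSet {d₁} {d₂} d₁≢d₂ d₁≢0 d₂≢0 = record
    { order    = order-size
    ; size     = CosetsWithIdentity-size d₁≢d₂ d₁≢0 d₂≢0
    ; products = products
    }
    where
    products : ∀ t → ¬ t ≡ idᴬ → HasSize (Factorisations _∘ᴬ_ (CosetsWithIdentity d₁ d₂) t) 4
    products t t≢id with b t ≟ d₁ | b t ≟ d₂
    ... | yes bt≡d₁ | _         = factorisations-through d₁≢d₂ d₁≢0 d₂≢0 t≢id bt≡d₁
    ... | no _      | yes bt≡d₂ =
      HasSize-cong (Factorisations-cong (λ f → mk⇔ (CosetsWithIdentity-swap f) (CosetsWithIdentity-swap f)) t)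
        (factorisations-through (d₁≢d₂ ∘ sym) d₂≢0 d₁≢0 t≢id bt≡d₂)
    ... | no bt≢d₁  | no bt≢d₂  = factorisations-avoiding d₁≢d₂ d₁≢0 d₂≢0 t≢id bt≢d₁ bt≢d₂

open import Data.Nat using (_*_)

corollary7p4 : (F : FiniteField) → let open Aff F in
    (g₁ g₂ : AffMap) →
    ¬ SameSet (leftCoset g₁ H) (leftCoset g₂ H) →
    ¬ SameSet (leftCoset g₁ H) H →
    ¬ SameSet (leftCoset g₂ H) H →
    IsSumSet _∘ᴬ_ idᴬ
      (λ f → leftCoset g₁ H f ⊎ leftCoset g₂ H f ⊎ f ≡ idᴬ)
      (FiniteField.order F * (FiniteField.order F ∸ 1))
      (2 * FiniteField.order F ∸ 1) 4
corollary7p4 F g₁ g₂ g₁H≠g₂H g₁H≠H g₂H≠H =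
  IsSumSet-cong (λ f → ⇔-sym (leftCoset-H⇔ g₁ f ⊎-⇔ (leftCoset-H⇔ g₂ f ⊎-⇔ ⇔-id _)))
    (CosetsWithIdentity-isSumSet
      (distinct-cosets⇒distinct-translations (leftCoset-H⇔ g₁) (leftCoset-H⇔ g₂) g₁H≠g₂H)
      (distinct-cosets⇒distinct-translations (leftCoset-H⇔ g₁) (λ _ → ⇔-id _) g₁H≠H)
      (distinct-cosets⇒distinct-translations (leftCoset-H⇔ g₂) (λ _ → ⇔-id _) g₂H≠H))
  where open AffineGroup F
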